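{- Let $n$ be a non-negative integer. If $\{(s_k),(\sigma_k)\}$, $k=0,1,2,\ldots$, is a binomial-transform pair of the first kind and $\{(\bar t_k),(\bar\tau_k)\}$, $k=0,1,2,\ldots$, is a binomial-transform pair of the second kind, then \[ \sum_{k=0}^n \binom{n}{k} s_k\,\bar t_{n-k} = \sum_{k=0}^n (-1)^k\binom{n}{k}\sigma_k\,\bar\tau_{n-k}. \]
   Context: Sequences $(s_k)_{k\ge0},(\sigma_k)_{k\ge0}$ of complex numbers form a binomial-transform pair of the first kind if $\sigma_n=\sum_{k=0}^n(-1)^k\binom nk s_k$ for all $n\ge0$. Sequences $(\bar t_k)_{k\ge0},(\bar\tau_k)_{k\ge0}$ of complex numbers form a binomial-transform pair of the second kind if $\bar\tau_n=\sum_{k=0}^n\binom nk\bar t_k$ for all $n\ge0$. -}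

module Defs where

open import Level using (Level)
open import Algebra.Bundles using (CommutativeRing)
open import Data.Nat using (ℕ; zero; suc)
open import Data.Nat.Combinatorics using (_C_)

module _ {c ℓ : Level} (R : CommutativeRing c ℓ) where
  open CommutativeRing R hiding (zero)

  ι : ℕ → Carrier
  ι zero    = 0#
  ι (suc n) = 1# + ι n

  sgn : ℕ → Carrier
  sgn zero    = 1#
  sgn (suc k) = - sgn k

  Σ≤ : ℕ → (ℕ → Carrier) → Carrier
  Σ≤ zero    f = f 0
  Σ≤ (suc n) f = Σ≤ n f + f (suc n)

  BinomialPairFirstKind : (ℕ → Carrier) → (ℕ → Carrier) → Set ℓ
  BinomialPairFirstKind s σ =
    ∀ n → σ n ≈ Σ≤ n (λ k → sgn k * ι (n C k) * s k)

  BinomialPairSecondKind : (ℕ → Carrier) → (ℕ → Carrier) → Set ℓ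
  BinomialPairSecondKind t τ =
    ∀ n → τ n ≈ Σ≤ n (λ k → ι (n C k) * t k)

-- Let B n g = Σ_{i+j=n} C(n,i) g i j. Pascal's rule turns into the Leibniz rule
-- B (n+1) g = B n (g (i+1) j) + B n (g i (j+1)). The iterated differences
-- dₙ(s) = Δⁿs(0) = (-1)ⁿ σₙ satisfy dₙ(s shifted) = dₙ(s) + dₙ₊₁(s), while
-- τₙ₊₁ = τₙ + τₙ(t shifted). Feeding these into the Leibniz rule, induction on n
-- (for all s and t at once) shows that replacing s by d(s) and t by τ leaves the
-- binomial convolution unchanged: e⁻ˣS(x) · eˣT(x) = S(x)T(x) for the exponential
-- generating functions.
module Submission where

open import Defs
open import Level using (Level)
open import Algebra.Bundles using (CommutativeRing)
open import Data.Nat using (ℕ; _∸_)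
open import Data.Nat.Combinatorics using (_C_)
open import Data.Nat using (zero; suc)
import Data.Nat as ℕ
open import Data.Nat.Properties using (≤-refl; m≤n⇒m≤1+n; n<1+n; +-∸-assoc)
open import Data.Nat.Combinatorics using (nCk+nC[k+1]≡[n+1]C[k+1]; k>n⇒nCk≡0)
open import Function using (_∘_)
import Relation.Binary.PropositionalEquality as ≡
import Algebra.Properties.AbelianGroup as AbelianGroupProperties
import Algebra.Properties.CommutativeSemigroup as CommutativeSemigroupProperties
import Algebra.Properties.Group as GroupProperties
import Algebra.Properties.Ring as RingProperties
import Relation.Binary.Reasoning.Setoid as SetoidReasoning

module _ {c ℓ : Level} (R : CommutativeRing c ℓ) where
  open CommutativeRing R hiding (zero)
  open SetoidReasoning setoid
  open RingProperties ring using (-‿distribˡ-*; -‿distribʳ-*; x[y-z]≈xy-xz)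
  open AbelianGroupProperties +-abelianGroup using (⁻¹-∙-comm; ⁻¹-anti-homo‿-)
  open GroupProperties +-group using (//-rightDividesˡ)
  open CommutativeSemigroupProperties +-commutativeSemigroup using (interchange; x∙yz≈y∙xz)
  open CommutativeSemigroupProperties *-commutativeSemigroup using (xy∙z≈y∙xz)

  ι-+ : ∀ a b → ι R (a ℕ.+ b) ≈ ι R a + ι R b
  ι-+ zero    b = sym (+-identityˡ _)
  ι-+ (suc a) b = trans (+-congˡ (ι-+ a b)) (sym (+-assoc _ _ _))

  ι-1 : ι R 1 ≈ 1#
  ι-1 = +-identityʳ 1#

  Σ≤-cong≤ : ∀ n {f g : ℕ → Carrier} → (∀ k → k ℕ.≤ n → f k ≈ g k) → Σ≤ R n f ≈ Σ≤ R n g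
  Σ≤-cong≤ zero    f≈g = f≈g 0 ℕ.z≤n
  Σ≤-cong≤ (suc n) f≈g = +-cong (Σ≤-cong≤ n (λ k k≤n → f≈g k (m≤n⇒m≤1+n k≤n))) (f≈g (suc n) ≤-refl)

  Σ≤-cong : ∀ n {f g : ℕ → Carrier} → (∀ k → f k ≈ g k) → Σ≤ R n f ≈ Σ≤ R n g
  Σ≤-cong n f≈g = Σ≤-cong≤ n (λ k _ → f≈g k)

  Σ≤-+ : ∀ n (f g : ℕ → Carrier) → Σ≤ R n (λ k → f k + g k) ≈ Σ≤ R n f + Σ≤ R n g
  Σ≤-+ zero    f g = refl
  Σ≤-+ (suc n) f g = trans (+-congʳ (Σ≤-+ n f g)) (interchange _ _ _ _)

  Σ≤-neg : ∀ n (f : ℕ → Carrier) → Σ≤ R n (λ k → - f k) ≈ - Σ≤ R n f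
  Σ≤-neg zero    f = refl
  Σ≤-neg (suc n) f = trans (+-congʳ (Σ≤-neg n f)) (⁻¹-∙-comm _ _)

  Σ≤-suc-head : ∀ n (f : ℕ → Carrier) → Σ≤ R (suc n) f ≈ f 0 + Σ≤ R n (f ∘ suc)
  Σ≤-suc-head zero    f = refl
  Σ≤-suc-head (suc n) f = trans (+-congʳ (Σ≤-suc-head n f)) (+-assoc _ _ _)

  binomialSum : ℕ → (ℕ → ℕ → Carrier) → Carrier
  binomialSum n g = Σ≤ R n (λ k → ι R (n C k) * g k (n ∸ k))

  binomialSum-cong : ∀ n {g h : ℕ → ℕ → Carrier} → (∀ i j → g i j ≈ h i j) →
                     binomialSum n g ≈ binomialSum n h
  binomialSum-cong n g≈h = Σ≤-cong n (λ k → *-congˡ (g≈h k (n ∸ k)))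

  binomialSum-+ : ∀ n (g h : ℕ → ℕ → Carrier) →
                  binomialSum n (λ i j → g i j + h i j) ≈ binomialSum n g + binomialSum n h
  binomialSum-+ n g h = trans (Σ≤-cong n (λ k → distribˡ _ _ _)) (Σ≤-+ n _ _)

  binomialSum-neg : ∀ n (g : ℕ → ℕ → Carrier) →
                    binomialSum n (λ i j → - g i j) ≈ - binomialSum n g
  binomialSum-neg n g = trans (Σ≤-cong n (λ k → sym (-‿distribʳ-* _ _))) (Σ≤-neg n _)

  binomialSum-shiftʳ : ∀ n (g : ℕ → ℕ → Carrier) →
    binomialSum n (λ i j → g i (suc j)) ≈ Σ≤ R (suc n) (λ k → ι R (n C k) * g k (suc n ∸ k))
  binomialSum-shiftʳ n g = begin
    binomialSum n (λ i j → g i (suc j))  ≈⟨ Σ≤-cong≤ n shift ⟩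
    Σ≤ R n h                             ≈⟨ +-identityʳ _ ⟨
    Σ≤ R n h + 0#                        ≈⟨ +-congˡ last≈0 ⟨
    Σ≤ R (suc n) h                       ∎
    where
    h : ℕ → Carrier
    h k = ι R (n C k) * g k (suc n ∸ k)
    shift : ∀ k → k ℕ.≤ n → ι R (n C k) * g k (suc (n ∸ k)) ≈ h k
    shift k k≤n = *-congˡ (reflexive (≡.cong (g k) (≡.sym (+-∸-assoc 1 k≤n))))
    last≈0 : h (suc n) ≈ 0#
    last≈0 = trans (*-congʳ (reflexive (≡.cong (ι R) (k>n⇒nCk≡0 (n<1+n n))))) (zeroˡ _)

  binomialSum-suc : ∀ n (g : ℕ → ℕ → Carrier) →
    binomialSum (suc n) g ≈ binomialSum n (λ i j → g (suc i) j) + binomialSum n (λ i j → g i (suc j))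
  binomialSum-suc n g = begin
    binomialSum (suc n) g
      ≈⟨ Σ≤-suc-head n _ ⟩
    ι R 1 * g 0 (suc n) + Σ≤ R n (λ k → ι R (suc n C suc k) * g (suc k) (n ∸ k))
      ≈⟨ +-congˡ (Σ≤-cong n pascal) ⟩
    ι R 1 * g 0 (suc n) + Σ≤ R n (λ k → ι R (n C k) * g (suc k) (n ∸ k) + ι R (n C suc k) * g (suc k) (n ∸ k))
      ≈⟨ +-congˡ (Σ≤-+ n _ _) ⟩
    ι R 1 * g 0 (suc n) + (binomialSum n (λ i j → g (suc i) j) + Σ≤ R n (λ k → ι R (n C suc k) * g (suc k) (n ∸ k)))
      ≈⟨ x∙yz≈y∙xz _ _ _ ⟩
    binomialSum n (λ i j → g (suc i) j) + (ι R 1 * g 0 (suc n) + Σ≤ R n (λ k → ι R (n C suc k) * g (suc k) (n ∸ k)))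
      ≈⟨ +-congˡ (Σ≤-suc-head n _) ⟨
    binomialSum n (λ i j → g (suc i) j) + Σ≤ R (suc n) (λ k → ι R (n C k) * g k (suc n ∸ k))
      ≈⟨ +-congˡ (binomialSum-shiftʳ n g) ⟨
    binomialSum n (λ i j → g (suc i) j) + binomialSum n (λ i j → g i (suc j)) ∎
    where
    pascal : ∀ k → ι R (suc n C suc k) * g (suc k) (n ∸ k)
                   ≈ ι R (n C k) * g (suc k) (n ∸ k) + ι R (n C suc k) * g (suc k) (n ∸ k)
    pascal k = begin
      ι R (suc n C suc k) * g (suc k) (n ∸ k)
        ≈⟨ *-congʳ (reflexive (≡.cong (ι R) (nCk+nC[k+1]≡[n+1]C[k+1] n k))) ⟨
      ι R (n C k ℕ.+ n C suc k) * g (suc k) (n ∸ k)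
        ≈⟨ trans (*-congʳ (ι-+ (n C k) (n C suc k))) (distribʳ _ _ _) ⟩
      ι R (n C k) * g (suc k) (n ∸ k) + ι R (n C suc k) * g (suc k) (n ∸ k) ∎

  binomialTransform : (ℕ → Carrier) → ℕ → Carrier
  binomialTransform t n = binomialSum n (λ i _ → t i)

  binomialTransform-zero : ∀ t → binomialTransform t 0 ≈ t 0
  binomialTransform-zero t = trans (*-congʳ ι-1) (*-identityˡ _)

  binomialTransform-suc : ∀ t n →
    binomialTransform t (suc n) ≈ binomialTransform (t ∘ suc) n + binomialTransform t n
  binomialTransform-suc t n = binomialSum-suc n (λ i _ → t i)

  alternatingBinomialTransform : (ℕ → Carrier) → ℕ → Carrier
  alternatingBinomialTransform s n = Σ≤ R n (λ k → sgn R k * ι R (n C k) * s k)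

  alternatingBinomialTransform≈binomialSum : ∀ s n →
    alternatingBinomialTransform s n ≈ binomialSum n (λ i _ → sgn R i * s i)
  alternatingBinomialTransform≈binomialSum s n = Σ≤-cong n (λ k → xy∙z≈y∙xz _ _ _)

  alternatingBinomialTransform-suc : ∀ s n →
    alternatingBinomialTransform s (suc n)
      ≈ alternatingBinomialTransform s n - alternatingBinomialTransform (s ∘ suc) n
  alternatingBinomialTransform-suc s n = begin
    alternatingBinomialTransform s (suc n)
      ≈⟨ alternatingBinomialTransform≈binomialSum s (suc n) ⟩
    binomialSum (suc n) (λ i _ → sgn R i * s i)
      ≈⟨ binomialSum-suc n (λ i _ → sgn R i * s i) ⟩
    binomialSum n (λ i _ → - sgn R i * s (suc i)) + binomialSum n (λ i _ → sgn R i * s i)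
      ≈⟨ +-congʳ (binomialSum-cong n (λ i _ → -‿distribˡ-* (sgn R i) (s (suc i)))) ⟨
    binomialSum n (λ i _ → - (sgn R i * s (suc i))) + binomialSum n (λ i _ → sgn R i * s i)
      ≈⟨ +-cong (binomialSum-neg n (λ i _ → sgn R i * s (suc i))) (sym (alternatingBinomialTransform≈binomialSum s n)) ⟩
    - binomialSum n (λ i _ → sgn R i * s (suc i)) + alternatingBinomialTransform s n
      ≈⟨ +-congʳ (-‿cong (alternatingBinomialTransform≈binomialSum (s ∘ suc) n)) ⟨
    - alternatingBinomialTransform (s ∘ suc) n + alternatingBinomialTransform s n
      ≈⟨ +-comm _ _ ⟩
    alternatingBinomialTransform s n - alternatingBinomialTransform (s ∘ suc) n ∎

  -- The n-th forward difference of s at 0: Δⁿs(0) = Σₖ (-1)ⁿ⁻ᵏ C(n,k) s k.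
  iteratedDifference : (ℕ → Carrier) → ℕ → Carrier
  iteratedDifference s n = sgn R n * alternatingBinomialTransform s n

  iteratedDifference-zero : ∀ s → iteratedDifference s 0 ≈ s 0
  iteratedDifference-zero s =
    trans (*-identityˡ _) (trans (*-congʳ (trans (*-identityˡ _) ι-1)) (*-identityˡ _))

  iteratedDifference-suc : ∀ s n →
    iteratedDifference s (suc n) + iteratedDifference s n ≈ iteratedDifference (s ∘ suc) n
  iteratedDifference-suc s n =
    trans (+-congʳ difference) (//-rightDividesˡ (iteratedDifference s n) _)
    where
    difference : iteratedDifference s (suc n) ≈ iteratedDifference (s ∘ suc) n - iteratedDifference s n
    difference = begin
      - sgn R n * alternatingBinomialTransform s (suc n)
        ≈⟨ -‿distribˡ-* _ _ ⟨
      - (sgn R n * alternatingBinomialTransform s (suc n))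
        ≈⟨ -‿cong (*-congˡ (alternatingBinomialTransform-suc s n)) ⟩
      - (sgn R n * (alternatingBinomialTransform s n - alternatingBinomialTransform (s ∘ suc) n))
        ≈⟨ -‿cong (x[y-z]≈xy-xz _ _ _) ⟩
      - (iteratedDifference s n - iteratedDifference (s ∘ suc) n)
        ≈⟨ ⁻¹-anti-homo‿- _ _ ⟩
      iteratedDifference (s ∘ suc) n - iteratedDifference s n ∎

  infixl 7 _⋆_
  _⋆_ : (ℕ → Carrier) → (ℕ → Carrier) → ℕ → Carrier
  (s ⋆ t) n = binomialSum n (λ i j → s i * t j)

  ⋆-suc : ∀ s t n → (s ⋆ t) (suc n) ≈ (s ∘ suc ⋆ t) n + (s ⋆ t ∘ suc) n
  ⋆-suc s t n = binomialSum-suc n (λ i j → s i * t j)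

  ⋆-iteratedDifference-binomialTransform : ∀ n s t →
    (s ⋆ t) n ≈ (iteratedDifference s ⋆ binomialTransform t) n
  ⋆-iteratedDifference-binomialTransform zero s t =
    *-congˡ (sym (*-cong (iteratedDifference-zero s) (binomialTransform-zero t)))
  ⋆-iteratedDifference-binomialTransform (suc n) s t = begin
    (s ⋆ t) (suc n)
      ≈⟨ ⋆-suc s t n ⟩
    (s ∘ suc ⋆ t) n + (s ⋆ t ∘ suc) n
      ≈⟨ +-cong (⋆-iteratedDifference-binomialTransform n (s ∘ suc) t)
                (⋆-iteratedDifference-binomialTransform n s (t ∘ suc)) ⟩
    (d (s ∘ suc) ⋆ V t) n + (d s ⋆ V (t ∘ suc)) n
      ≈⟨ binomialSum-+ n (λ i j → d (s ∘ suc) i * V t j) (λ i j → d s i * V (t ∘ suc) j) ⟨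
    binomialSum n (λ i j → d (s ∘ suc) i * V t j + d s i * V (t ∘ suc) j)
      ≈⟨ binomialSum-cong n regroup ⟩
    binomialSum n (λ i j → d s (suc i) * V t j + d s i * V t (suc j))
      ≈⟨ binomialSum-+ n (λ i j → d s (suc i) * V t j) (λ i j → d s i * V t (suc j)) ⟩
    (d s ∘ suc ⋆ V t) n + (d s ⋆ V t ∘ suc) n
      ≈⟨ ⋆-suc (d s) (V t) n ⟨
    (d s ⋆ V t) (suc n) ∎
    where
    d = iteratedDifference
    V = binomialTransform
    regroup : ∀ i j → d (s ∘ suc) i * V t j + d s i * V (t ∘ suc) j
                      ≈ d s (suc i) * V t j + d s i * V t (suc j)
    regroup i j = begin
      d (s ∘ suc) i * V t j + d s i * V (t ∘ suc) j
        ≈⟨ +-congʳ (*-congʳ (iteratedDifference-suc s i)) ⟨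
      (d s (suc i) + d s i) * V t j + d s i * V (t ∘ suc) j
        ≈⟨ trans (+-congʳ (distribʳ _ _ _)) (+-assoc _ _ _) ⟩
      d s (suc i) * V t j + (d s i * V t j + d s i * V (t ∘ suc) j)
        ≈⟨ +-congˡ (trans (sym (distribˡ _ _ _)) (*-congˡ (+-comm _ _))) ⟩
      d s (suc i) * V t j + d s i * (V (t ∘ suc) j + V t j)
        ≈⟨ +-congˡ (*-congˡ (binomialTransform-suc t j)) ⟨
      d s (suc i) * V t j + d s i * V t (suc j) ∎

theorem8 : {c ℓ : Level} (R : CommutativeRing c ℓ) →
    let open CommutativeRing R in
    (s σ t τ : ℕ → Carrier) →
    BinomialPairFirstKind R s σ →
    BinomialPairSecondKind R t τ →
    (n : ℕ) →
    Σ≤ R n (λ k → ι R (n C k) * s k * t (n ∸ k))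
      ≈ Σ≤ R n (λ k → sgn R k * ι R (n C k) * σ k * τ (n ∸ k))
theorem8 R s σ t τ σ≈ τ≈ n = begin
  Σ≤ R n (λ k → ι R (n C k) * s k * t (n ∸ k))
    ≈⟨ Σ≤-cong R n (λ k → *-assoc _ _ _) ⟩
  _⋆_ R s t n
    ≈⟨ ⋆-iteratedDifference-binomialTransform R n s t ⟩
  _⋆_ R (iteratedDifference R s) (binomialTransform R t) n
    ≈⟨ binomialSum-cong R n (λ i j → *-cong (*-congˡ {sgn R i} (σ≈ i)) (τ≈ j)) ⟨
  binomialSum R n (λ i j → sgn R i * σ i * τ j)
    ≈⟨ Σ≤-cong R n (λ k → trans (*-congʳ (xy∙z≈y∙xz (sgn R k) (ι R (n C k)) (σ k))) (*-assoc _ _ (τ (n ∸ k)))) ⟨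
  Σ≤ R n (λ k → sgn R k * ι R (n C k) * σ k * τ (n ∸ k)) ∎
  where
  open CommutativeRing R hiding (zero)
  open SetoidReasoning setoid
  open CommutativeSemigroupProperties *-commutativeSemigroup using (xy∙z≈y∙xz)
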